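{- Let $D$ be a quasi difference set in a commutative group $\mathsf G=\langle G,\cdot,1\rangle$ satisfying: whenever $d_1,d_2,d_3,d_4\in D$ and $d_1d_2^{ -1}d_3d_4^{ -1}\in DD^{ -1}$, then $d_1d_2^{ -1}=1$ or $d_3d_4^{ -1}=1$ or $d_1d_4^{ -1}=1$ or $d_3d_2^{ -1}=1$. Then the structure $\mathbf D(\mathsf G,D)$ is Veblenian.
   Context: For a group $\mathsf G$ and $D\subseteq G$, $\mathbf D(\mathsf G,D)$ is the incidence structure whose points are the elements of $G$ and whose lines are the translates $b\cdot D$, $b\in G$, incidence being membership. $D$ is a quasi difference set if for every $c\neq 1$ there is at most one pair $(a,b)\in D\times D$ with $ab^{ -1}=c$. $DD^{ -1}=\{xy^{ -1}\colon x,y\in D\}$. An incidence structure is Veblenian if for every point $p$, any two distinct lines $L_1,L_2$ through $p$, and any two lines $K_1,K_2$ not through $p$ each of which meets both $L_1$ and $L_2$, the lines $K_1$ and $K_2$ have a common point. -}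

module Defs where

open import Level using (Level; _⊔_; suc)
open import Algebra.Bundles using (AbelianGroup)
open import Data.Product using (Σ; _×_; _,_; ∃; ∃-syntax)
open import Data.Sum using (_⊎_)
open import Relation.Nullary using (¬_)
open import Relation.Unary using (Pred)
open import Relation.Binary.Core using (Rel)

module _ {c ℓ : Level} (G : AbelianGroup c ℓ) where
  open AbelianGroup G

  RespectsEq : {ℓ′ : Level} → Pred Carrier ℓ′ → Set (c ⊔ ℓ ⊔ ℓ′)
  RespectsEq D = ∀ {x y} → x ≈ y → D x → D y

  module _ {ℓ′ : Level} (D : Pred Carrier ℓ′) where

    IsQuasiDifferenceSet : Set (c ⊔ ℓ ⊔ ℓ′)
    IsQuasiDifferenceSet =
      ∀ (z a b a′ b′ : Carrier) → ¬ (z ≈ ε) →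
      D a → D b → D a′ → D b′ →
      a ∙ b ⁻¹ ≈ z → a′ ∙ b′ ⁻¹ ≈ z →
      (a ≈ a′) × (b ≈ b′)

    InDD⁻¹ : Pred Carrier (c ⊔ ℓ ⊔ ℓ′)
    InDD⁻¹ z = ∃[ x ] ∃[ y ] (D x × D y × z ≈ x ∙ y ⁻¹)

    FourCondition : Set (c ⊔ ℓ ⊔ ℓ′)
    FourCondition =
      ∀ (d₁ d₂ d₃ d₄ : Carrier) → D d₁ → D d₂ → D d₃ → D d₄ →
      InDD⁻¹ ((d₁ ∙ d₂ ⁻¹) ∙ (d₃ ∙ d₄ ⁻¹)) →
      (d₁ ∙ d₂ ⁻¹ ≈ ε) ⊎ (d₃ ∙ d₄ ⁻¹ ≈ ε) ⊎ (d₁ ∙ d₄ ⁻¹ ≈ ε) ⊎ (d₃ ∙ d₂ ⁻¹ ≈ ε)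

    -- The incidence structure D(G,D): points = elements of G,
    -- lines = translates b·D (a line is named by a translating element b),
    -- incidence = membership.
    _I_ : Carrier → Carrier → Set (c ⊔ ℓ ⊔ ℓ′)
    p I b = ∃[ d ] (D d × p ≈ b ∙ d)

    SameLine : Carrier → Carrier → Set (c ⊔ ℓ ⊔ ℓ′)
    SameLine b b′ = ∀ p → ((p I b → p I b′) × (p I b′ → p I b))

    Meet : Carrier → Carrier → Set (c ⊔ ℓ ⊔ ℓ′)
    Meet b b′ = ∃[ q ] (q I b × q I b′)

    Veblenian : Set (c ⊔ ℓ ⊔ ℓ′)
    Veblenian =
      ∀ (p l₁ l₂ k₁ k₂ : Carrier) →
      p I l₁ → p I l₂ → ¬ SameLine l₁ l₂ →
      ¬ (p I k₁) → ¬ (p I k₂) →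
      Meet k₁ l₁ → Meet k₁ l₂ → Meet k₂ l₁ → Meet k₂ l₂ →
      Meet k₁ k₂

module Submission where

-- Let p = l₁a₁ = l₂a₂ lie on the distinct lines l₁D, l₂D, and let
-- kD be a line avoiding p that meets l₁D in kx₁ = l₁y₁ and l₂D in
-- kx₂ = l₂y₂.  Reading off quotients of D-coordinates gives
--   (x₁y₁⁻¹)(y₂x₂⁻¹) = (l₁k⁻¹)(kl₂⁻¹) = l₁l₂⁻¹ = a₂a₁⁻¹ ∈ DD⁻¹,
-- so the four-element condition applies.  Three of its alternatives force
-- p onto kD (directly, or after the quasi difference property identifies
-- coordinates); the remaining one, y₁ = y₂, forces a₂ = x₁, i.e. the point
-- k·a₂ lies on l₁D.  Applying this to both lines k₁D and k₂D of the Veblen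
-- configuration, k₁a₂ = l₁y and k₂a₂ = l₁w, whence k₁w = k₂y is a common
-- point of k₁D and k₂D.

open import Defs
open import Level using (Level)
open import Algebra.Bundles using (AbelianGroup)
open import Relation.Unary using (Pred)
open import Data.Product using (_,_; _×_; ∃-syntax; proj₁; proj₂)
open import Data.Sum using (inj₁; inj₂)
open import Data.Empty using (⊥-elim)
open import Relation.Nullary using (¬_)
import Algebra.Properties.AbelianGroup as AbelianGroupProperties
import Algebra.Solver.CommutativeMonoid as CommutativeMonoidSolver
import Relation.Binary.Reasoning.Setoid as SetoidReasoning

module Quotients {c ℓ : Level} (G : AbelianGroup c ℓ) where
  open AbelianGroup G
  open AbelianGroupProperties G using (∙-cancelʳ; \\-leftDividesʳ)
  open CommutativeMonoidSolver commutativeMonoid using (solve; _⊕_; _⊜_)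
  open SetoidReasoning setoid

  cancel-equal : ∀ {a b x y} → a ∙ x ≈ b ∙ y → x ≈ y → a ≈ b
  cancel-equal {a} {b} {x} ax≈by x≈y =
    ∙-cancelʳ x a b (trans ax≈by (∙-congˡ (sym x≈y)))

  quotient-cancel : ∀ x y z → (x ∙ y ⁻¹) ∙ (y ∙ z) ≈ x ∙ z
  quotient-cancel x y z =
    trans (assoc x (y ⁻¹) (y ∙ z)) (∙-congˡ (\\-leftDividesʳ y z))

  telescope : ∀ x y z → (x ∙ y ⁻¹) ∙ (y ∙ z ⁻¹) ≈ x ∙ z ⁻¹
  telescope x y z = quotient-cancel x y (z ⁻¹)

  telescope′ : ∀ x y z → (x ∙ y ⁻¹) ∙ (z ∙ x ⁻¹) ≈ z ∙ y ⁻¹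
  telescope′ x y z = trans (comm _ _) (telescope z x y)

  quotient-swap : ∀ {a b c d} → a ∙ b ≈ c ∙ d → b ∙ d ⁻¹ ≈ c ∙ a ⁻¹
  quotient-swap {a} {b} {c} {d} ab≈cd = ∙-cancelʳ (d ∙ a) _ _ (begin
    (b ∙ d ⁻¹) ∙ (d ∙ a)  ≈⟨ quotient-cancel b d a ⟩
    b ∙ a                 ≈⟨ comm b a ⟩
    a ∙ b                 ≈⟨ ab≈cd ⟩
    c ∙ d                 ≈⟨ quotient-cancel c a d ⟨
    (c ∙ a ⁻¹) ∙ (a ∙ d)  ≈⟨ ∙-congˡ (comm a d) ⟩
    (c ∙ a ⁻¹) ∙ (d ∙ a)  ∎)

  common-shift : ∀ {k₁ k₂ l a u w} →
    k₁ ∙ a ≈ l ∙ u → k₂ ∙ a ≈ l ∙ w → k₁ ∙ w ≈ k₂ ∙ u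
  common-shift {k₁} {k₂} {l} {a} {u} {w} k₁a≈lu k₂a≈lw =
    ∙-cancelʳ (a ∙ l) _ _ (begin
      (k₁ ∙ w) ∙ (a ∙ l)   ≈⟨ rearrange k₁ w a l ⟩
      (k₁ ∙ a) ∙ (l ∙ w)   ≈⟨ ∙-cong k₁a≈lu (sym k₂a≈lw) ⟩
      (l ∙ u) ∙ (k₂ ∙ a)   ≈⟨ rearrange′ l u k₂ a ⟩
      (k₂ ∙ u) ∙ (a ∙ l)   ∎)
    where
    rearrange : ∀ x y z t → (x ∙ y) ∙ (z ∙ t) ≈ (x ∙ z) ∙ (t ∙ y)
    rearrange = solve 4 (λ x y z t → (x ⊕ y) ⊕ (z ⊕ t) ⊜ (x ⊕ z) ⊕ (t ⊕ y)) refl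
    rearrange′ : ∀ x y z t → (x ∙ y) ∙ (z ∙ t) ≈ (z ∙ y) ∙ (t ∙ x)
    rearrange′ = solve 4 (λ x y z t → (x ⊕ y) ⊕ (z ⊕ t) ⊜ (z ⊕ y) ⊕ (t ⊕ x)) refl

module Translates {c ℓ ℓ′ : Level} (G : AbelianGroup c ℓ)
  (D : Pred (AbelianGroup.Carrier G) ℓ′) where
  open AbelianGroup G
  open Quotients G using (common-shift)

  equal-names-same-line : ∀ {l₁ l₂} → l₁ ≈ l₂ → SameLine G D l₁ l₂
  equal-names-same-line l₁≈l₂ p =
      (λ { (d , Dd , p≈l₁d) → d , Dd , trans p≈l₁d (∙-congʳ l₁≈l₂) })
    , (λ { (d , Dd , p≈l₂d) → d , Dd , trans p≈l₂d (∙-congʳ (sym l₁≈l₂)) })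

  crossing : ∀ {k l} → Meet G D k l →
    ∃[ x ] ∃[ y ] (D x × D y × k ∙ x ≈ l ∙ y)
  crossing (q , (x , Dx , q≈kx) , (y , Dy , q≈ly)) =
    x , y , Dx , Dy , trans (sym q≈kx) q≈ly

  common-shift-meet : ∀ {k₁ k₂ l a} →
    _I_ G D (k₁ ∙ a) l → _I_ G D (k₂ ∙ a) l → Meet G D k₁ k₂
  common-shift-meet {k₁} (u , Du , k₁a≈lu) (w , Dw , k₂a≈lw) =
    k₁ ∙ w , (w , Dw , refl) , (u , Du , common-shift k₁a≈lu k₂a≈lw)

module KeyLemma {c ℓ ℓ′ : Level} (G : AbelianGroup c ℓ)
  (D : Pred (AbelianGroup.Carrier G) ℓ′)
  (quasi : IsQuasiDifferenceSet G D) (four : FourCondition G D) where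
  open AbelianGroup G
  open AbelianGroupProperties G using (x∙y⁻¹≈ε⇒x≈y)
  open Quotients G
  open Translates G D using (crossing)
  open SetoidReasoning setoid

  module Transversal {p l₁ l₂ k a₁ a₂ x₁ y₁ x₂ y₂ : Carrier}
    (Da₁ : D a₁) (Da₂ : D a₂) (Dx₁ : D x₁) (Dy₁ : D y₁) (Dx₂ : D x₂) (Dy₂ : D y₂)
    (p≈l₁a₁ : p ≈ l₁ ∙ a₁) (p≈l₂a₂ : p ≈ l₂ ∙ a₂) (l₁≉l₂ : ¬ (l₁ ≈ l₂))
    (p∉k : ¬ (_I_ G D p k))
    (kx₁≈l₁y₁ : k ∙ x₁ ≈ l₁ ∙ y₁) (kx₂≈l₂y₂ : k ∙ x₂ ≈ l₂ ∙ y₂) where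

    l₂a₂≈l₁a₁ : l₂ ∙ a₂ ≈ l₁ ∙ a₁
    l₂a₂≈l₁a₁ = trans (sym p≈l₂a₂) p≈l₁a₁

    nontrivial : ¬ (a₂ ∙ a₁ ⁻¹ ≈ ε)
    nontrivial a₂a₁⁻¹≈ε =
      l₁≉l₂ (sym (cancel-equal l₂a₂≈l₁a₁ (x∙y⁻¹≈ε⇒x≈y a₂ a₁ a₂a₁⁻¹≈ε)))

    product : (x₁ ∙ y₁ ⁻¹) ∙ (y₂ ∙ x₂ ⁻¹) ≈ a₂ ∙ a₁ ⁻¹
    product = begin
      (x₁ ∙ y₁ ⁻¹) ∙ (y₂ ∙ x₂ ⁻¹)  ≈⟨ ∙-cong (quotient-swap kx₁≈l₁y₁)
                                            (quotient-swap (sym kx₂≈l₂y₂)) ⟩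
      (l₁ ∙ k ⁻¹) ∙ (k ∙ l₂ ⁻¹)    ≈⟨ telescope l₁ k l₂ ⟩
      l₁ ∙ l₂ ⁻¹                   ≈⟨ quotient-swap l₂a₂≈l₁a₁ ⟨
      a₂ ∙ a₁ ⁻¹                   ∎

    product-in-DD⁻¹ : InDD⁻¹ G D ((x₁ ∙ y₁ ⁻¹) ∙ (y₂ ∙ x₂ ⁻¹))
    product-in-DD⁻¹ = a₂ , a₁ , Da₂ , Da₁ , product

    same-pair : ∀ {u v} → D u → D v → u ∙ v ⁻¹ ≈ a₂ ∙ a₁ ⁻¹ →
      (a₂ ≈ u) × (a₁ ≈ v)
    same-pair Du Dv uv⁻¹≈a₂a₁⁻¹ =
      quasi _ a₂ a₁ _ _ nontrivial Da₂ Da₁ Du Dv refl uv⁻¹≈a₂a₁⁻¹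

    case-x₁≈y₁ : ¬ (x₁ ∙ y₁ ⁻¹ ≈ ε)
    case-x₁≈y₁ h = p∉k (a₁ , Da₁ , trans p≈l₁a₁ (∙-congʳ (sym k≈l₁)))
      where
      k≈l₁ : k ≈ l₁
      k≈l₁ = cancel-equal kx₁≈l₁y₁ (x∙y⁻¹≈ε⇒x≈y x₁ y₁ h)

    case-x₂≈y₂ : ¬ (y₂ ∙ x₂ ⁻¹ ≈ ε)
    case-x₂≈y₂ h = p∉k (a₂ , Da₂ , trans p≈l₂a₂ (∙-congʳ (sym k≈l₂)))
      where
      k≈l₂ : k ≈ l₂
      k≈l₂ = cancel-equal kx₂≈l₂y₂ (sym (x∙y⁻¹≈ε⇒x≈y y₂ x₂ h))

    -- If x₁ = x₂, then y₂y₁⁻¹ = a₂a₁⁻¹, so a₁ = y₁ and p = l₁y₁ = kx₁.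
    case-x₁≈x₂ : ¬ (x₁ ∙ x₂ ⁻¹ ≈ ε)
    case-x₁≈x₂ h = p∉k (x₁ , Dx₁ , (begin
        p        ≈⟨ p≈l₁a₁ ⟩
        l₁ ∙ a₁  ≈⟨ ∙-congˡ a₁≈y₁ ⟩
        l₁ ∙ y₁  ≈⟨ kx₁≈l₁y₁ ⟨
        k ∙ x₁   ∎))
      where
      x₁≈x₂ : x₁ ≈ x₂
      x₁≈x₂ = x∙y⁻¹≈ε⇒x≈y x₁ x₂ h
      a₁≈y₁ : a₁ ≈ y₁
      a₁≈y₁ = proj₂ (same-pair Dy₂ Dy₁ (begin
        y₂ ∙ y₁ ⁻¹                   ≈⟨ telescope′ x₁ y₁ y₂ ⟨
        (x₁ ∙ y₁ ⁻¹) ∙ (y₂ ∙ x₁ ⁻¹)  ≈⟨ ∙-congˡ (∙-congˡ (⁻¹-cong x₁≈x₂)) ⟩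
        (x₁ ∙ y₁ ⁻¹) ∙ (y₂ ∙ x₂ ⁻¹)  ≈⟨ product ⟩
        a₂ ∙ a₁ ⁻¹                   ∎))

    -- If y₁ = y₂, then x₁x₂⁻¹ = a₂a₁⁻¹, so a₂ = x₁ and k·a₂ = kx₁ = l₁y₁.
    case-y₁≈y₂ : y₂ ∙ y₁ ⁻¹ ≈ ε → _I_ G D (k ∙ a₂) l₁
    case-y₁≈y₂ h = y₁ , Dy₁ , trans (∙-congˡ a₂≈x₁) kx₁≈l₁y₁
      where
      y₂≈y₁ : y₂ ≈ y₁
      y₂≈y₁ = x∙y⁻¹≈ε⇒x≈y y₂ y₁ h
      a₂≈x₁ : a₂ ≈ x₁
      a₂≈x₁ = proj₁ (same-pair Dx₁ Dx₂ (begin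
        x₁ ∙ x₂ ⁻¹                   ≈⟨ telescope x₁ y₁ x₂ ⟨
        (x₁ ∙ y₁ ⁻¹) ∙ (y₁ ∙ x₂ ⁻¹)  ≈⟨ ∙-congˡ (∙-congʳ (sym y₂≈y₁)) ⟩
        (x₁ ∙ y₁ ⁻¹) ∙ (y₂ ∙ x₂ ⁻¹)  ≈⟨ product ⟩
        a₂ ∙ a₁ ⁻¹                   ∎))

    shifted-point : _I_ G D (k ∙ a₂) l₁
    shifted-point with four x₁ y₁ y₂ x₂ Dx₁ Dy₁ Dy₂ Dx₂ product-in-DD⁻¹
    ... | inj₁ h               = ⊥-elim (case-x₁≈y₁ h)
    ... | inj₂ (inj₁ h)        = ⊥-elim (case-x₂≈y₂ h)
    ... | inj₂ (inj₂ (inj₁ h)) = ⊥-elim (case-x₁≈x₂ h)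
    ... | inj₂ (inj₂ (inj₂ h)) = case-y₁≈y₂ h

  shifted-point-on-line : ∀ {p l₁ l₂ k a₁ a₂} → D a₁ → D a₂ →
    p ≈ l₁ ∙ a₁ → p ≈ l₂ ∙ a₂ → ¬ (l₁ ≈ l₂) → ¬ (_I_ G D p k) →
    Meet G D k l₁ → Meet G D k l₂ → _I_ G D (k ∙ a₂) l₁
  shifted-point-on-line Da₁ Da₂ p≈l₁a₁ p≈l₂a₂ l₁≉l₂ p∉k k∩l₁ k∩l₂
    with crossing k∩l₁ | crossing k∩l₂
  ... | _ , _ , Dx₁ , Dy₁ , kx₁≈l₁y₁ | _ , _ , Dx₂ , Dy₂ , kx₂≈l₂y₂ =
    Transversal.shifted-point Da₁ Da₂ Dx₁ Dy₁ Dx₂ Dy₂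
      p≈l₁a₁ p≈l₂a₂ l₁≉l₂ p∉k kx₁≈l₁y₁ kx₂≈l₂y₂

-- The theorem.
proposition4p1 : {c ℓ ℓ′ : Level} (G : AbelianGroup c ℓ)
    (D : Pred (AbelianGroup.Carrier G) ℓ′) →
    RespectsEq G D →
    IsQuasiDifferenceSet G D →
    FourCondition G D →
    Veblenian G D
proposition4p1 G D _ quasi four p l₁ l₂ k₁ k₂ (a₁ , Da₁ , p≈l₁a₁) (a₂ , Da₂ , p≈l₂a₂)
    distinct p∉k₁ p∉k₂ k₁∩l₁ k₁∩l₂ k₂∩l₁ k₂∩l₂ =
  common-shift-meet (shifted k₁∩l₁ k₁∩l₂ p∉k₁) (shifted k₂∩l₁ k₂∩l₂ p∉k₂)
  where
  open AbelianGroup G using (_≈_; _∙_)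
  open Translates G D using (equal-names-same-line; common-shift-meet)
  open KeyLemma G D quasi four using (shifted-point-on-line)

  l₁≉l₂ : ¬ (l₁ ≈ l₂)
  l₁≉l₂ l₁≈l₂ = distinct (equal-names-same-line l₁≈l₂)

  shifted : ∀ {k} → Meet G D k l₁ → Meet G D k l₂ → ¬ (_I_ G D p k) →
    _I_ G D (k ∙ a₂) l₁
  shifted k∩l₁ k∩l₂ p∉k = shifted-point-on-line Da₁ Da₂ p≈l₁a₁ p≈l₂a₂ l₁≉l₂ p∉k k∩l₁ k∩l₂
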